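{- For $n\geq 3$, $vs_{\chi'}(P_n)=vs_{\Delta}(P_n)=\gamma(P_{n-2})=\lceil \frac{n-2}{3}\rceil$, where $P_n$ is the path on $n$ vertices and $\gamma$ denotes the domination number.
   Context: All graphs are finite and simple. $\chi'$ is the chromatic index and $\Delta$ the maximum degree. For a graph invariant $\rho$, the $\rho$-vertex stability number $vs_{\rho}(G)$ is the minimum number of vertices of $G$ whose removal results in a graph $H\subseteq G$ with $\rho(H)\neq\rho(G)$ or with $E(H)=\emptyset$. -}

module Defs where

open import Data.Bool using (Bool; true; false; _∧_; _∨_; not)
open import Data.Nat using (ℕ; zero; suc; _+_; _∸_; _≤_; _⊔_; _≡ᵇ_; _/_)
open import Data.Fin using (Fin; toℕ)
open import Data.Fin.Subset using (Subset; _∈_; ∣_∣)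
open import Data.Vec using (Vec; tabulate; lookup)
open import Data.List using (List; foldr; map; allFin)
open import Data.Product using (Σ; ∃; ∃-syntax; _×_)
open import Data.Sum using (_⊎_)
open import Relation.Binary.PropositionalEquality using (_≡_; _≢_)
open import Relation.Nullary using (¬_)

-- A (finite, simple) graph on the vertex set Fin n, given by a Boolean
-- adjacency function (intended symmetric and loopless).
Graph : ℕ → Set
Graph n = Fin n → Fin n → Bool

P : (n : ℕ) → Graph n
P n i j = (suc (toℕ i) ≡ᵇ toℕ j) ∨ (suc (toℕ j) ≡ᵇ toℕ i)

-- Removed vertices lose all their
-- edges (they are kept as isolated vertices, which affects neither the
-- edge set, the chromatic index, nor the maximum degree of a graph with
-- an edge).
_─_ : ∀ {n} → Graph n → Subset n → Graph n
(G ─ S) u v = G u v ∧ not (lookup S u) ∧ not (lookup S v)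

Edgeless : ∀ {n} → Graph n → Set
Edgeless {n} G = (u v : Fin n) → G u v ≡ false

deg : ∀ {n} → Graph n → Fin n → ℕ
deg G v = ∣ tabulate (G v) ∣

Δ : ∀ {n} → Graph n → ℕ
Δ {n} G = foldr _⊔_ 0 (map (deg G) (allFin n))

IsMinimum : (ℕ → Set) → ℕ → Set
IsMinimum P k = P k × ((m : ℕ) → P m → k ≤ m)

ProperEdgeColouring : ∀ {n} → Graph n → (k : ℕ) → (Fin n → Fin n → Fin k) → Set
ProperEdgeColouring {n} G k c =
  ((u v : Fin n) → G u v ≡ true → c u v ≡ c v u) ×
  ((u v w : Fin n) → G u v ≡ true → G u w ≡ true → v ≢ w → c u v ≢ c u w)

EdgeColourable : ∀ {n} → Graph n → ℕ → Set
EdgeColourable {n} G k = ∃[ c ] ProperEdgeColouring G k c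

IsChromaticIndex : ∀ {n} → Graph n → ℕ → Set
IsChromaticIndex G = IsMinimum (EdgeColourable G)

IsMaxDegree : ∀ {n} → Graph n → ℕ → Set
IsMaxDegree G k = Δ G ≡ k

Invariant : Set₁
Invariant = ∀ {n} → Graph n → ℕ → Set

Differs : Invariant → ∀ {n} → Graph n → Graph n → Set
Differs ρ H G = ∃[ a ] ∃[ b ] (ρ H a × ρ G b × a ≢ b)

Destabilising : Invariant → ∀ {n} → Graph n → ℕ → Set
Destabilising ρ {n} G k =
  ∃[ S ] (∣ S ∣ ≡ k × (Differs ρ (G ─ S) G ⊎ Edgeless (G ─ S)))

IsVertexStability : Invariant → ∀ {n} → Graph n → ℕ → Set
IsVertexStability ρ G = IsMinimum (Destabilising ρ G)

Dominating : ∀ {n} → Graph n → Subset n → Set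
Dominating {n} G D = (v : Fin n) → v ∈ D ⊎ (∃[ u ] (u ∈ D × G u v ≡ true))

IsDominationNumber : ∀ {n} → Graph n → ℕ → Set
IsDominationNumber {n} G = IsMinimum (λ k → ∃[ D ] (Dominating G D × ∣ D ∣ ≡ k))

⌈_/3⌉ : ℕ → ℕ
⌈ m /3⌉ = (m + 2) / 3

module Submission where

-- Everything rests on one counting fact about a set S of positions
-- 0, …, n-1 (gap-or-count): either S misses three consecutive positions
-- (a "gap"), or ∣ S ∣ ≥ ⌊ n / 3 ⌋.
--
-- For P_n - S a gap is exactly what produces a vertex of degree two (a
-- "cherry"), while without a gap every vertex keeps at most one neighbour
-- (a matching).  Every subgraph of a path is properly 2-edge-coloured by
-- the parity of the smaller endpoint, so a subgraph of P_n with a cherry has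
-- χ' = Δ = 2 = χ'(P_n) = Δ(P_n), whereas a matching has χ' = 1 and Δ ≤ 1.
-- Deleting every third vertex (⌊ n / 3 ⌋ vertices) leaves a matching, and
-- any smaller deletion leaves a gap; this gives vs = ⌊ n / 3 ⌋, which is
-- ⌈ (n - 2) / 3 ⌉ (path-stability, for any invariant behaving like χ', Δ).
--
-- For domination, a dominating set D of P_m, padded by an absent position
-- at each end, has no gap, so the same counting gives ∣ D ∣ ≥ ⌈ m / 3 ⌉;
-- the centres 1, 4, 7, … (plus the last vertex if needed) attain it.

open import Defs
open import Data.Nat using (ℕ; _≤_; _∸_)
open import Data.Product using (_×_)

open import Data.Bool using (Bool; true; false; _∧_; _∨_; not)
open import Data.Bool.Properties using (T-≡; ∨-zeroʳ)
open import Data.Empty using (⊥; ⊥-elim)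
open import Data.Fin using (Fin; toℕ; fromℕ<) renaming (zero to fzero; suc to fsuc)
open import Data.Fin.Properties using (toℕ-fromℕ<; toℕ-injective; toℕ<n)
import Data.Fin.Properties as Fin
open import Data.Fin.Subset using (Subset; _∈_; ∣_∣; inside; outside)
open import Data.Fin.Subset.Properties using (∣p∣≤∣x∷p∣)
open import Data.List using (List; foldr; map; allFin)
import Data.List as List
import Data.List.Membership.Propositional as List
open import Data.List.Membership.Propositional.Properties using (∈-allFin)
open import Data.List.Relation.Unary.Any using (here; there)
open import Data.Nat using (zero; suc; _+_; _<_; _⊓_; _⊔_; _/_; _≡ᵇ_; z≤n; s≤s)
open import Data.Nat.DivMod using (m/n≡1+[m∸n]/n)
open import Data.Nat.Properties
open import Data.Product using (∃-syntax; _,_; proj₁)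
open import Data.Sum using (_⊎_; inj₁; inj₂)
open import Data.Vec using ([]; _∷_; lookup; tabulate; _∷ʳ_)
import Data.Vec.Base as Vec
open import Function.Bundles using (Equivalence)
open import Relation.Binary.PropositionalEquality
open import Relation.Nullary using (¬_)

∨-true : ∀ a b → a ∨ b ≡ true → a ≡ true ⊎ b ≡ true
∨-true true  _ _ = inj₁ refl
∨-true false _ e = inj₂ e

∧-true : ∀ a b → a ∧ b ≡ true → a ≡ true × b ≡ true
∧-true true true _ = refl , refl

not-true : ∀ a → not a ≡ true → a ≡ false
not-true false _ = refl

clash : ∀ {b} → b ≡ true → b ≡ false → ⊥
clash refl ()

≡ᵇ-true⇒≡ : ∀ m n → (m ≡ᵇ n) ≡ true → m ≡ n
≡ᵇ-true⇒≡ m n e = ≡ᵇ⇒≡ m n (Equivalence.from T-≡ e)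

≡⇒≡ᵇ-true : ∀ m n → m ≡ n → (m ≡ᵇ n) ≡ true
≡⇒≡ᵇ-true m n e = Equivalence.to T-≡ (≡⇒≡ᵇ m n e)

[3+m]/3 : ∀ m → (3 + m) / 3 ≡ suc (m / 3)
[3+m]/3 m = m/n≡1+[m∸n]/n {3 + m} {3} (s≤s (s≤s (s≤s z≤n)))

-- Membership of position i in S, read as false beyond the end; natural
-- number positions let us speak about the run i, i + 1, i + 2 directly.
at : ∀ {n} → Subset n → ℕ → Bool
at []       _       = false
at (x ∷ _)  zero    = x
at (_ ∷ xs) (suc i) = at xs i

at-lookup : ∀ {n} (S : Subset n) (v : Fin n) → lookup S v ≡ at S (toℕ v)
at-lookup (_ ∷ S) fzero    = refl
at-lookup (_ ∷ S) (fsuc v) = at-lookup S v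

∈⇒at : ∀ {n} {S : Subset n} {v : Fin n} → v ∈ S → at S (toℕ v) ≡ true
∈⇒at Vec.here      = refl
∈⇒at (Vec.there p) = ∈⇒at p

Gap : ∀ {n} → Subset n → Set
Gap {n} S = ∃[ i ] (2 + i < n × at S i ≡ false × at S (1 + i) ≡ false × at S (2 + i) ≡ false)

block : ∀ a b c {n} (r : Subset n) →
        (a ≡ false × b ≡ false × c ≡ false) ⊎ suc ∣ r ∣ ≤ ∣ a ∷ b ∷ c ∷ r ∣
block true  b     c     r = inj₂ (s≤s (≤-trans (∣p∣≤∣x∷p∣ c r) (∣p∣≤∣x∷p∣ b (c ∷ r))))
block false true  c     r = inj₂ (s≤s (∣p∣≤∣x∷p∣ c r))
block false false true  r = inj₂ ≤-refl
block false false false r = inj₁ (refl , refl , refl)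

-- The counting fact: a set meeting every run of three positions has at
-- least ⌊ n / 3 ⌋ elements (cut 0, …, n-1 into disjoint blocks of three).
gap-or-count : ∀ {n} (S : Subset n) → Gap S ⊎ n / 3 ≤ ∣ S ∣
gap-or-count []           = inj₂ z≤n
gap-or-count (_ ∷ [])     = inj₂ z≤n
gap-or-count (_ ∷ _ ∷ []) = inj₂ z≤n
gap-or-count {suc (suc (suc m))} (a ∷ b ∷ c ∷ r) with block a b c r | gap-or-count r
... | inj₁ (refl , refl , refl) | _ = inj₁ (0 , s≤s (s≤s (s≤s z≤n)) , refl , refl , refl)
... | inj₂ _ | inj₁ (i , i<m , gap) = inj₁ (3 + i , s≤s (s≤s (s≤s i<m)) , gap)
... | inj₂ grows | inj₂ small = inj₂ (begin
  (3 + m) / 3            ≡⟨ [3+m]/3 m ⟩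
  suc (m / 3)            ≤⟨ s≤s small ⟩
  suc ∣ r ∣              ≤⟨ grows ⟩
  ∣ a ∷ b ∷ c ∷ r ∣      ∎)
  where open ≤-Reasoning

Adjacent : ℕ → ℕ → Set
Adjacent a b = b ≡ suc a ⊎ a ≡ suc b

P-adjacent : ∀ {n} (u v : Fin n) → P n u v ≡ true → Adjacent (toℕ u) (toℕ v)
P-adjacent u v e with ∨-true _ _ e
... | inj₁ x = inj₁ (sym (≡ᵇ-true⇒≡ _ _ x))
... | inj₂ x = inj₂ (sym (≡ᵇ-true⇒≡ _ _ x))

adjacent-P : ∀ {n} {u v : Fin n} → Adjacent (toℕ u) (toℕ v) → P n u v ≡ true
adjacent-P (inj₁ e) rewrite ≡⇒≡ᵇ-true _ _ (sym e) = refl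
adjacent-P (inj₂ e) rewrite ≡⇒≡ᵇ-true _ _ (sym e) = ∨-zeroʳ _

_⊆ᴳ_ : ∀ {n} → Graph n → Graph n → Set
_⊆ᴳ_ {n} G H = (u v : Fin n) → G u v ≡ true → H u v ≡ true

─-edge : ∀ {n} (G : Graph n) (S : Subset n) u v → (G ─ S) u v ≡ true →
         G u v ≡ true × at S (toℕ u) ≡ false × at S (toℕ v) ≡ false
─-edge G S u v e with ∧-true _ _ e
... | uv , e′ with ∧-true _ _ e′
... | u∉ , v∉ =
  uv , trans (sym (at-lookup S u)) (not-true _ u∉) , trans (sym (at-lookup S v)) (not-true _ v∉)

edge-─ : ∀ {n} (G : Graph n) (S : Subset n) u v → G u v ≡ true →
         at S (toℕ u) ≡ false → at S (toℕ v) ≡ false → (G ─ S) u v ≡ true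
edge-─ G S u v uv u∉ v∉ rewrite uv | at-lookup S u | u∉ | at-lookup S v | v∉ = refl

⊆ᴳ-refl : ∀ {n} (G : Graph n) → G ⊆ᴳ G
⊆ᴳ-refl G _ _ e = e

─-⊆ : ∀ {n} (G : Graph n) (S : Subset n) → (G ─ S) ⊆ᴳ G
─-⊆ G S u v e = proj₁ (─-edge G S u v e)

Cherry : ∀ {n} → Graph n → Set
Cherry {n} G = ∃[ u ] ∃[ v ] ∃[ w ] (G u v ≡ true × G u w ≡ true × v ≢ w)

Matching : ∀ {n} → Graph n → Set
Matching {n} G = (u v w : Fin n) → G u v ≡ true → G u w ≡ true → v ≡ w

cherry-path : ∀ {n} → 3 ≤ n → Cherry (P n)
cherry-path (s≤s (s≤s (s≤s _))) = fsuc fzero , fzero , fsuc (fsuc fzero) , refl , refl , λ ()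

OutsideRun : ∀ {n} → Subset n → Fin n → Fin n → Fin n → Set
OutsideRun S x y z =
  toℕ y ≡ suc (toℕ x) × toℕ z ≡ suc (toℕ y) ×
  at S (toℕ x) ≡ false × at S (toℕ y) ≡ false × at S (toℕ z) ≡ false

run⇒gap : ∀ {n} {S : Subset n} {x y z} → OutsideRun S x y z → Gap S
run⇒gap {S = S} {x} {y} {z} (y≡ , z≡ , x∉ , y∉ , z∉) =
  toℕ x , subst (_< _) z≡2+x (toℕ<n z) ,
  x∉ , subst (λ k → at S k ≡ false) y≡ y∉ , subst (λ k → at S k ≡ false) z≡2+x z∉
  where
  z≡2+x : toℕ z ≡ 2 + toℕ x
  z≡2+x = trans z≡ (cong suc y≡)

gap⇒run : ∀ {n} {S : Subset n} → Gap S → ∃[ x ] ∃[ y ] ∃[ z ] OutsideRun S x y z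
gap⇒run {S = S} (i , 2+i<n , x∉ , y∉ , z∉) =
  fromℕ< i<n , fromℕ< 1+i<n , fromℕ< 2+i<n ,
  trans (toℕ-fromℕ< 1+i<n) (cong suc (sym (toℕ-fromℕ< i<n))) ,
  trans (toℕ-fromℕ< 2+i<n) (cong suc (sym (toℕ-fromℕ< 1+i<n))) ,
  outside-at (toℕ-fromℕ< i<n) x∉ , outside-at (toℕ-fromℕ< 1+i<n) y∉ ,
  outside-at (toℕ-fromℕ< 2+i<n) z∉
  where
  1+i<n = <-trans (n<1+n (1 + i)) 2+i<n
  i<n   = <-trans (n<1+n i) 1+i<n
  outside-at : ∀ {j k} → j ≡ k → at S k ≡ false → at S j ≡ false
  outside-at j≡k = subst (λ j → at S j ≡ false) (sym j≡k)

-- The middle vertex of an outside run keeps both of its neighbours.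
run⇒cherry : ∀ {n} {S : Subset n} {x y z} → OutsideRun S x y z → Cherry (P n ─ S)
run⇒cherry {n} {S} {x} {y} {z} (y≡ , z≡ , x∉ , y∉ , z∉) =
  y , x , z ,
  edge-─ (P n) S y x (adjacent-P (inj₂ y≡)) y∉ x∉ ,
  edge-─ (P n) S y z (adjacent-P (inj₁ z≡)) y∉ z∉ ,
  λ x≡z → <⇒≢ (≤-trans (n≤1+n _) (≤-reflexive (trans (cong suc (sym y≡)) (sym z≡))))
               (cong toℕ x≡z)

-- Without a gap, two distinct neighbours u - 1, u + 1 of u cannot both
-- survive, since u - 1, u, u + 1 would be an outside run.
gapless⇒matching : ∀ {n} (S : Subset n) → ¬ Gap S → Matching (P n ─ S)
gapless⇒matching {n} S no-gap u v w uv uw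
  with ─-edge (P n) S u v uv | ─-edge (P n) S u w uw
... | Puv , u∉ , v∉ | Puw , _ , w∉ =
  toℕ-injective (neighbours (P-adjacent u v Puv) (P-adjacent u w Puw))
  where
  neighbours : Adjacent (toℕ u) (toℕ v) → Adjacent (toℕ u) (toℕ w) → toℕ v ≡ toℕ w
  neighbours (inj₁ v≡) (inj₁ w≡) = trans v≡ (sym w≡)
  neighbours (inj₂ u≡) (inj₂ u≡′) = suc-injective (trans (sym u≡) u≡′)
  neighbours (inj₁ v≡) (inj₂ u≡) =
    ⊥-elim (no-gap (run⇒gap {S = S} {w} {u} {v} (u≡ , v≡ , w∉ , u∉ , v∉)))
  neighbours (inj₂ u≡) (inj₁ w≡) =
    ⊥-elim (no-gap (run⇒gap {S = S} {v} {u} {w} (u≡ , w≡ , v∉ , u∉ , w∉)))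

minimum-unique : ∀ {Q : ℕ → Set} {a b} → IsMinimum Q a → IsMinimum Q b → a ≡ b
minimum-unique (qa , a-min) (qb , b-min) = ≤-antisym (a-min _ qb) (b-min _ qa)

parity : ℕ → Fin 2
parity zero          = fzero
parity (suc zero)    = fsuc fzero
parity (suc (suc k)) = parity k

parity-suc : ∀ k → parity k ≢ parity (suc k)
parity-suc zero          ()
parity-suc (suc zero)    ()
parity-suc (suc (suc k)) = parity-suc k

-- The two edges at a path vertex a go to a - 1 and a + 1; their smaller
-- endpoints a - 1 and a have different parities.
parity-distinct : ∀ a b c → Adjacent a b → Adjacent a c → b ≢ c → parity (a ⊓ b) ≢ parity (a ⊓ c)
parity-distinct a b c (inj₁ refl) (inj₁ refl) b≢c = ⊥-elim (b≢c refl)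
parity-distinct a b c (inj₂ refl) (inj₂ c≡) b≢c = ⊥-elim (b≢c (suc-injective c≡))
parity-distinct .(suc c) .(suc (suc c)) c (inj₁ refl) (inj₂ refl) _
  rewrite m≤n⇒m⊓n≡m (n≤1+n (suc c)) | m≥n⇒m⊓n≡n (n≤1+n c) = λ e → parity-suc c (sym e)
parity-distinct .(suc b) b .(suc (suc b)) (inj₂ refl) (inj₁ refl) _
  rewrite m≤n⇒m⊓n≡m (n≤1+n (suc b)) | m≥n⇒m⊓n≡n (n≤1+n b) = parity-suc b

path-2-colourable : ∀ {n} (G : Graph n) → G ⊆ᴳ P n → EdgeColourable G 2
path-2-colourable G G⊆P =
  (λ u v → parity (toℕ u ⊓ toℕ v)) ,
  (λ u v _ → cong parity (⊓-comm (toℕ u) (toℕ v))) ,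
  (λ u v w uv uw v≢w → parity-distinct (toℕ u) (toℕ v) (toℕ w)
      (P-adjacent u v (G⊆P u v uv)) (P-adjacent u w (G⊆P u w uw)) (λ e → v≢w (toℕ-injective e)))

-- A subgraph of a path with a cherry has chromatic index exactly 2: two
-- colours suffice, and the two edges of the cherry must differ.
χ'-cherry : ∀ {n} (G : Graph n) → G ⊆ᴳ P n → Cherry G → IsChromaticIndex G 2
χ'-cherry G G⊆P (u , v , w , uv , uw , v≢w) = path-2-colourable G G⊆P , at-least-2
  where
  at-least-2 : ∀ k → EdgeColourable G k → 2 ≤ k
  at-least-2 zero          (c , _) with c u u
  ... | ()
  at-least-2 (suc zero)    (c , _ , proper) with c u v | c u w | proper u v w uv uw v≢w
  ... | fzero | fzero | distinct = ⊥-elim (distinct refl)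
  at-least-2 (suc (suc _)) _ = s≤s (s≤s z≤n)

-- A matching on a nonempty vertex set has chromatic index 1 (one colour
-- suffices, and the colour type Fin 0 of a 0-colouring is empty).
χ'-matching : ∀ {n} (G : Graph n) → Fin n → Matching G → IsChromaticIndex G 1
χ'-matching G x matching =
  ((λ _ _ → fzero) , (λ _ _ _ → refl) , (λ u v w uv uw v≢w _ → v≢w (matching u v w uv uw))) ,
  at-least-1
  where
  at-least-1 : ∀ k → EdgeColourable G k → 1 ≤ k
  at-least-1 zero    (c , _) with c x x
  ... | ()
  at-least-1 (suc _) _ = s≤s z≤n

#true : ∀ {n} → (Fin n → Bool) → ℕ
#true f = ∣ tabulate f ∣

#true-none : ∀ {n} (f : Fin n → Bool) → (∀ j → f j ≡ false) → #true f ≡ 0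
#true-none {zero}  f none = refl
#true-none {suc n} f none rewrite none fzero = #true-none (λ j → f (fsuc j)) (λ j → none (fsuc j))

#true-≤1 : ∀ {n} (f : Fin n → Bool) →
           (∀ j j′ → f j ≡ true → f j′ ≡ true → j ≡ j′) → #true f ≤ 1
#true-≤1 {zero}  f unique = z≤n
#true-≤1 {suc n} f unique with f fzero in f0
... | true  = s≤s (≤-reflexive (#true-none (λ j → f (fsuc j)) rest-false))
  where
  rest-false : ∀ j → f (fsuc j) ≡ false
  rest-false j with f (fsuc j) in fj
  ... | true  with unique fzero (fsuc j) f0 fj
  ...   | ()
  rest-false j | false = refl
... | false = #true-≤1 (λ j → f (fsuc j))
                (λ j j′ fj fj′ → Fin.suc-injective (unique (fsuc j) (fsuc j′) fj fj′))

#true-≥1 : ∀ {n} (f : Fin n → Bool) j → f j ≡ true → 1 ≤ #true f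
#true-≥1 f fzero    fj rewrite fj = s≤s z≤n
#true-≥1 f (fsuc j) fj =
  ≤-trans (#true-≥1 (λ j → f (fsuc j)) j fj) (∣p∣≤∣x∷p∣ (f fzero) (tabulate (λ j → f (fsuc j))))

#true-≥2 : ∀ {n} (f : Fin n → Bool) j j′ → f j ≡ true → f j′ ≡ true → j ≢ j′ → 2 ≤ #true f
#true-≥2 f fzero    fzero     _  _   j≢j′ = ⊥-elim (j≢j′ refl)
#true-≥2 f fzero    (fsuc j′) fj fj′ _    rewrite fj  = s≤s (#true-≥1 (λ j → f (fsuc j)) j′ fj′)
#true-≥2 f (fsuc j) fzero     fj fj′ _    rewrite fj′ = s≤s (#true-≥1 (λ j → f (fsuc j)) j fj)
#true-≥2 f (fsuc j) (fsuc j′) fj fj′ j≢j′ =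
  ≤-trans (#true-≥2 (λ j → f (fsuc j)) j j′ fj fj′ (λ e → j≢j′ (cong fsuc e)))
          (∣p∣≤∣x∷p∣ (f fzero) (tabulate (λ j → f (fsuc j))))

#true-mono : ∀ {n} (f g : Fin n → Bool) → (∀ j → f j ≡ true → g j ≡ true) → #true f ≤ #true g
#true-mono {zero}  f g f⇒g = z≤n
#true-mono {suc n} f g f⇒g with f fzero in f0
... | true rewrite f⇒g fzero f0 =
  s≤s (#true-mono (λ j → f (fsuc j)) (λ j → g (fsuc j)) (λ j → f⇒g (fsuc j)))
... | false = ≤-trans (#true-mono (λ j → f (fsuc j)) (λ j → g (fsuc j)) (λ j → f⇒g (fsuc j)))
                      (∣p∣≤∣x∷p∣ (g fzero) (tabulate (λ j → g (fsuc j))))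

#true-∨ : ∀ {n} (f g : Fin n → Bool) → #true (λ j → f j ∨ g j) ≤ #true f + #true g
#true-∨ {zero}  f g = z≤n
#true-∨ {suc n} f g with f fzero | g fzero | #true-∨ (λ j → f (fsuc j)) (λ j → g (fsuc j))
... | true  | true  | ih = s≤s (≤-trans ih (+-monoʳ-≤ (#true (λ j → f (fsuc j))) (n≤1+n _)))
... | true  | false | ih = s≤s ih
... | false | true  | ih = ≤-trans (s≤s ih) (≤-reflexive (sym (+-suc _ _)))
... | false | false | ih = ih

deg-path : ∀ n (v : Fin n) → deg (P n) v ≤ 2
deg-path n v =
  ≤-trans (#true-∨ succ pred) (+-mono-≤ (#true-≤1 succ succ-unique) (#true-≤1 pred pred-unique))
  where
  succ pred : Fin n → Bool
  succ j = suc (toℕ v) ≡ᵇ toℕ j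
  pred j = suc (toℕ j) ≡ᵇ toℕ v
  succ-unique : ∀ j j′ → succ j ≡ true → succ j′ ≡ true → j ≡ j′
  succ-unique j j′ sj sj′ =
    toℕ-injective (trans (sym (≡ᵇ-true⇒≡ (suc (toℕ v)) _ sj)) (≡ᵇ-true⇒≡ (suc (toℕ v)) _ sj′))
  pred-unique : ∀ j j′ → pred j ≡ true → pred j′ ≡ true → j ≡ j′
  pred-unique j j′ pj pj′ =
    toℕ-injective (suc-injective
      (trans (≡ᵇ-true⇒≡ _ (toℕ v) pj) (sym (≡ᵇ-true⇒≡ _ (toℕ v) pj′))))

foldr-⊔-≤ : ∀ {A : Set} (f : A → ℕ) {k} (xs : List A) →
            (∀ x → f x ≤ k) → foldr _⊔_ 0 (map f xs) ≤ k
foldr-⊔-≤ f List.[]        bound = z≤n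
foldr-⊔-≤ f (x List.∷ xs) bound = ⊔-lub (bound x) (foldr-⊔-≤ f xs bound)

≤-foldr-⊔ : ∀ {A : Set} (f : A → ℕ) {x} {xs : List A} →
            x List.∈ xs → f x ≤ foldr _⊔_ 0 (map f xs)
≤-foldr-⊔ f (here refl) = m≤m⊔n _ _
≤-foldr-⊔ f (there x∈)  = ≤-trans (≤-foldr-⊔ f x∈) (m≤n⊔m _ _)

Δ-≤ : ∀ {n} (G : Graph n) {k} → (∀ v → deg G v ≤ k) → Δ G ≤ k
Δ-≤ {n} G = foldr-⊔-≤ (deg G) (allFin n)

deg-≤-Δ : ∀ {n} (G : Graph n) v → deg G v ≤ Δ G
deg-≤-Δ G v = ≤-foldr-⊔ (deg G) (∈-allFin v)

Δ-cherry : ∀ {n} (G : Graph n) → G ⊆ᴳ P n → Cherry G → Δ G ≡ 2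
Δ-cherry {n} G G⊆P (u , v , w , uv , uw , v≢w) = ≤-antisym
  (Δ-≤ G (λ x → ≤-trans (#true-mono (G x) (P n x) (G⊆P x)) (deg-path n x)))
  (≤-trans (#true-≥2 (G u) v w uv uw v≢w) (deg-≤-Δ G u))

Δ-matching : ∀ {n} (G : Graph n) → Matching G → Δ G ≤ 1
Δ-matching G matching = Δ-≤ G (λ x → #true-≤1 (G x) (matching x))

thirds : ∀ n → Subset n
thirds (suc (suc (suc n))) = outside ∷ outside ∷ inside ∷ thirds n
thirds (suc (suc zero))    = outside ∷ outside ∷ []
thirds (suc zero)          = outside ∷ []
thirds zero                = []

∣thirds∣ : ∀ n → ∣ thirds n ∣ ≡ n / 3
∣thirds∣ (suc (suc (suc n))) = trans (cong suc (∣thirds∣ n)) (sym ([3+m]/3 n))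
∣thirds∣ (suc (suc zero))    = refl
∣thirds∣ (suc zero)          = refl
∣thirds∣ zero                = refl

thirds-gapless : ∀ n → ¬ Gap (thirds n)
thirds-gapless (suc (suc (suc n))) (0 , _ , _ , _ , ())
thirds-gapless (suc (suc (suc n))) (1 , _ , _ , () , _)
thirds-gapless (suc (suc (suc n))) (2 , _ , () , _ , _)
thirds-gapless (suc (suc (suc n))) (suc (suc (suc i)) , s≤s (s≤s (s≤s i<n)) , gap) =
  thirds-gapless n (i , i<n , gap)
thirds-gapless (suc (suc zero)) (_ , s≤s (s≤s ()) , _)
thirds-gapless (suc zero)       (_ , s≤s () , _)
thirds-gapless zero             (_ , () , _)

path-stability : (ρ : Invariant) (n : ℕ) → 3 ≤ n → ρ (P n) 2 →
  (∀ (G : Graph n) → G ⊆ᴳ P n → Cherry G → ∀ a → ρ G a → a ≡ 2) →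
  (∃[ a ] (ρ (P n ─ thirds n) a × a ≢ 2)) →
  IsVertexStability ρ (P n) (n / 3)
path-stability ρ n 3≤n ρP≡2 cherry⇒2 (a , ρ-thirds , a≢2) =
  (thirds n , ∣thirds∣ n , inj₁ (a , 2 , ρ-thirds , ρP≡2 , a≢2)) , minimal
  where
  minimal : ∀ k → Destabilising ρ (P n) k → n / 3 ≤ k
  minimal k (S , ∣S∣≡k , outcome) with gap-or-count S
  ... | inj₂ large = subst (n / 3 ≤_) ∣S∣≡k large
  ... | inj₁ gap with gap⇒run {S = S} gap
  ...   | _ , _ , _ , run with run⇒cherry {S = S} run | outcome
  ...     | cherry | inj₁ (b , c , ρb , ρc , b≢c) =
    ⊥-elim (b≢c (trans (cherry⇒2 (P n ─ S) (─-⊆ (P n) S) cherry b ρb)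
                       (sym (cherry⇒2 (P n) (⊆ᴳ-refl (P n)) (cherry-path 3≤n) c ρc))))
  ...     | (u , v , _ , uv , _) | inj₂ edgeless = ⊥-elim (clash uv (edgeless u v))

centres : ∀ m → Subset m
centres (suc (suc (suc m))) = outside ∷ inside ∷ outside ∷ centres m
centres (suc (suc zero))    = inside ∷ outside ∷ []
centres (suc zero)          = inside ∷ []
centres zero                = []

∣centres∣ : ∀ m → ∣ centres m ∣ ≡ ⌈ m /3⌉
∣centres∣ (suc (suc (suc m))) = trans (cong suc (∣centres∣ m)) (sym ([3+m]/3 (m + 2)))
∣centres∣ (suc (suc zero))    = refl
∣centres∣ (suc zero)          = refl
∣centres∣ zero                = refl

-- Vertices 3 + u, 3 + v of P (3 + m) are adjacent exactly when u, v are
-- adjacent in P m (definitionally), so the pattern repeats every three vertices.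
centres-dominating : ∀ m → Dominating (P m) (centres m)
centres-dominating (suc (suc (suc m))) fzero               = inj₂ (fsuc fzero , Vec.there Vec.here , refl)
centres-dominating (suc (suc (suc m))) (fsuc fzero)        = inj₁ (Vec.there Vec.here)
centres-dominating (suc (suc (suc m))) (fsuc (fsuc fzero)) = inj₂ (fsuc fzero , Vec.there Vec.here , refl)
centres-dominating (suc (suc (suc m))) (fsuc (fsuc (fsuc v))) with centres-dominating m v
... | inj₁ v∈             = inj₁ (Vec.there (Vec.there (Vec.there v∈)))
... | inj₂ (u , u∈ , uv) = inj₂ (fsuc (fsuc (fsuc u)) , Vec.there (Vec.there (Vec.there u∈)) , uv)
centres-dominating (suc (suc zero)) fzero        = inj₁ Vec.here
centres-dominating (suc (suc zero)) (fsuc fzero) = inj₂ (fzero , Vec.here , refl)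
centres-dominating (suc zero)       fzero        = inj₁ Vec.here

pad : ∀ {m} → Subset m → Subset (2 + m)
pad D = outside ∷ (D ∷ʳ outside)

at-pad : ∀ {m} (D : Subset m) j → at (pad D) (suc j) ≡ at D j
at-pad []      zero    = refl
at-pad []      (suc j) = refl
at-pad (_ ∷ D) zero    = refl
at-pad (_ ∷ D) (suc j) = at-pad D j

∣pad∣ : ∀ {m} (D : Subset m) → ∣ pad D ∣ ≡ ∣ D ∣
∣pad∣ []            = refl
∣pad∣ (outside ∷ D) = ∣pad∣ D
∣pad∣ (inside ∷ D)  = cong suc (∣pad∣ D)

InWindow : ℕ → ℕ → Set
InWindow k t = k ≡ t ⊎ k ≡ 1 + t ⊎ k ≡ 2 + t

-- A vertex v dominated by D leaves an element of pad D among the positions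
-- v, v + 1, v + 2 (which stand for v - 1, v, v + 1); so pad D has no gap.
window : ∀ {m} (D : Subset m) → Dominating (P m) D → ∀ v →
         ∃[ k ] (at (pad D) k ≡ true × InWindow k (toℕ v))
window D dominating v with dominating v
... | inj₁ v∈ = suc (toℕ v) , trans (at-pad D (toℕ v)) (∈⇒at v∈) , inj₂ (inj₁ refl)
... | inj₂ (u , u∈ , uv) =
  suc (toℕ u) , trans (at-pad D (toℕ u)) (∈⇒at u∈) , position (P-adjacent u v uv)
  where
  position : Adjacent (toℕ u) (toℕ v) → InWindow (suc (toℕ u)) (toℕ v)
  position (inj₁ v≡) = inj₁ (sym v≡)
  position (inj₂ u≡) = inj₂ (inj₂ (cong suc u≡))

dominating-≥ : ∀ {m} (D : Subset m) → Dominating (P m) D → ⌈ m /3⌉ ≤ ∣ D ∣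
dominating-≥ {m} D dominating with gap-or-count (pad D)
... | inj₂ large = begin
  (m + 2) / 3  ≡⟨ cong (_/ 3) (+-comm m 2) ⟩
  (2 + m) / 3  ≤⟨ large ⟩
  ∣ pad D ∣    ≡⟨ ∣pad∣ D ⟩
  ∣ D ∣        ∎
  where open ≤-Reasoning
... | inj₁ (i , s≤s (s≤s i<m) , i∉ , 1+i∉ , 2+i∉)
  with window D dominating (fromℕ< i<m)
...   | k , k∈ , near = ⊥-elim (missed k∈ (subst (InWindow k) (toℕ-fromℕ< i<m) near))
  where
  missed : ∀ {k} → at (pad D) k ≡ true → InWindow k i → ⊥
  missed k∈ (inj₁ refl)         = clash k∈ i∉
  missed k∈ (inj₂ (inj₁ refl))  = clash k∈ 1+i∉
  missed k∈ (inj₂ (inj₂ refl))  = clash k∈ 2+i∉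

domination-number-path : ∀ m → IsDominationNumber (P m) ⌈ m /3⌉
domination-number-path m =
  (centres m , centres-dominating m , ∣centres∣ m) ,
  λ k (D , dominating , ∣D∣≡k) → subst (⌈ m /3⌉ ≤_) ∣D∣≡k (dominating-≥ D dominating)

⌈n∸2/3⌉≡n/3 : ∀ n → ⌈ n ∸ 2 /3⌉ ≡ n / 3
⌈n∸2/3⌉≡n/3 zero          = refl
⌈n∸2/3⌉≡n/3 (suc zero)    = refl
⌈n∸2/3⌉≡n/3 (suc (suc k)) = cong (_/ 3) (+-comm k 2)

mainTheorem8 : (n : ℕ) → 3 ≤ n →
    IsVertexStability IsChromaticIndex (P n) ⌈ n ∸ 2 /3⌉ ×
    IsVertexStability IsMaxDegree (P n) ⌈ n ∸ 2 /3⌉ ×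
    IsDominationNumber (P (n ∸ 2)) ⌈ n ∸ 2 /3⌉
mainTheorem8 n 3≤n =
  rescale IsChromaticIndex χ'-stability , rescale IsMaxDegree Δ-stability ,
  domination-number-path (n ∸ 2)
  where
  rescale : ∀ (ρ : Invariant) →
            IsVertexStability ρ (P n) (n / 3) → IsVertexStability ρ (P n) ⌈ n ∸ 2 /3⌉
  rescale ρ = subst (IsVertexStability ρ (P n)) (sym (⌈n∸2/3⌉≡n/3 n))

  matching : Matching (P n ─ thirds n)
  matching = gapless⇒matching (thirds n) (thirds-gapless n)

  χ'-stability : IsVertexStability IsChromaticIndex (P n) (n / 3)
  χ'-stability = path-stability IsChromaticIndex n 3≤n
    (χ'-cherry (P n) (⊆ᴳ-refl (P n)) (cherry-path 3≤n))
    (λ G G⊆P cherry a χ'≡a → minimum-unique χ'≡a (χ'-cherry G G⊆P cherry))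
    (1 , χ'-matching (P n ─ thirds n) (fromℕ< (≤-trans (s≤s z≤n) 3≤n)) matching , λ ())

  Δ-stability : IsVertexStability IsMaxDegree (P n) (n / 3)
  Δ-stability = path-stability IsMaxDegree n 3≤n
    (Δ-cherry (P n) (⊆ᴳ-refl (P n)) (cherry-path 3≤n))
    (λ G G⊆P cherry a Δ≡a → trans (sym Δ≡a) (Δ-cherry G G⊆P cherry))
    (Δ (P n ─ thirds n) , refl ,
     λ Δ≡2 → 1+n≰n (subst (_≤ 1) Δ≡2 (Δ-matching (P n ─ thirds n) matching)))
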